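{- Let $q$ be any prime power, $n\geq 1$, and $S\subseteq GF(q)^n$ a vector space over $GF(q)$. If $\mathrm{mult}(S)$ is ideal and minimally non-packing, then $\tau(\mathrm{mult}(S),\mathbf{1})=2$.
   Context: A clutter $\mathcal{C}$ over a finite ground set $V$ is a family of subsets of $V$, no member containing another; $M(\mathcal{C})$ is its member-element incidence matrix. $\mathcal{C}$ is ideal if every extreme point of $\{x\in\mathbb{R}^V: x\geq\mathbf{0}, M(\mathcal{C})x\geq\mathbf{1}\}$ is integral. $\tau(\mathcal{C},\mathbf{1})=\min\{\mathbf{1}^\top x: M(\mathcal{C})x\geq\mathbf{1}, x\in\mathbb{Z}_+^V\}$ and $\nu(\mathcal{C},\mathbf{1})=\max\{\mathbf{1}^\top y: M(\mathcal{C})^\top y\leq \mathbf{1}, y\in\mathbb{Z}_+^{\mathcal{C}}\}$. $\mathcal{C}$ packs if $\tau(\mathcal{C},\mathbf{1})=\nu(\mathcal{C},\mathbf{1})$, has the packing property if every minor packs, and is minimally non-packing if it does not have the packing property but every proper minor does. For disjoint $I,J\subseteq V$, the minor $\mathcal{C}\setminus I/J$ is the clutter over $V-(I\cup J)$ of inclusion-minimal sets of $\{C-J: C\in\mathcal{C}, C\cap I=\emptyset\}$; it is proper if $I\cup J\neq\emptyset$. For a vector space $S\subseteq GF(q)^n$, take $n$ disjoint copies $V_1,\dots,V_n$ of $GF(q)$; $\mathrm{mult}(S)$ is the clutter over $V_1\cup\cdots\cup V_n$ with members $\{x_1,\dots,x_n\}$ ($x_i$ in copy $V_i$) for $(x_1,\dots,x_n)\in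 S$. -}

module Defs where

open import Level using (0ℓ)
open import Data.Nat as ℕ using (ℕ; zero; suc; _^_)
open import Data.Nat.Primality using (Prime)
open import Data.Integer using (ℤ)
open import Data.Rational as ℚ using (ℚ; 0ℚ; 1ℚ)
open import Data.Fin using (Fin; combine)
open import Data.Fin.Subset using (Subset; _∈_; _∉_; _⊆_; _∩_; _∪_; _─_; Empty; Nonempty; ⊤)
open import Data.Vec using (lookup)
open import Data.Bool using (Bool; true; false; if_then_else_)
open import Data.List using (List; []; _∷_; length; filter)
open import Data.List.Relation.Unary.All using (All)
open import Data.Product using (Σ; ∃; _×_; _,_)
open import Data.Sum using (_⊎_)
open import Relation.Nullary using (¬_; Dec; yes; no)
open import Relation.Binary.PropositionalEquality using (_≡_; _≢_)
open import Algebra.Structures using (IsCommutativeRing)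
open import Data.Fin.Subset.Properties using (_∈?_)

IsPrimePower : ℕ → Set
IsPrimePower q = Σ ℕ λ p → Σ ℕ λ k → Prime p × q ≡ p ^ suc k

-- A field whose carrier is the finite set Fin q (so it has exactly q
-- elements); for a prime power q this is GF(q) up to isomorphism.
record FiniteField (q : ℕ) : Set where
  field
    _+_ _*_      : Fin q → Fin q → Fin q
    -_           : Fin q → Fin q
    0# 1#        : Fin q
    isCommutativeRing : IsCommutativeRing _≡_ _+_ _*_ -_ 0# 1#
    0≢1          : 0# ≢ 1#
    inverse      : ∀ x → x ≢ 0# → Σ (Fin q) λ y → x * y ≡ 1#

record IsSubspace {q : ℕ} (F : FiniteField q) (n : ℕ)
                  (S : (Fin n → Fin q) → Set) : Set where
  open FiniteField F
  field
    zero∈  : S (λ _ → 0#)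
    +-closed : ∀ {u v} → S u → S v → S (λ i → u i + v i)
    ·-closed : ∀ (c : Fin q) {u} → S u → S (λ i → c * u i)

Family : ℕ → Set₁
Family m = Subset m → Set

-- mult(S): ground set V₁ ∪ … ∪ Vₙ, the copy of a ∈ GF(q) in Vᵢ being
-- the element  combine i a  of Fin (n * q).
mult : {q n : ℕ} → ((Fin n → Fin q) → Set) → Family (n ℕ.* q)
mult {q} {n} S C =
  Σ (Fin n → Fin q) λ s → S s ×
    (∀ v → (v ∈ C → Σ (Fin n) λ i → v ≡ combine i (s i))
         × (Σ (Fin n) (λ i → v ≡ combine i (s i)) → v ∈ C))

minor : {m : ℕ} → Family m → Subset m → Subset m → Family m
minor 𝒞 I J C' = pre C' × (∀ D → pre D → D ⊆ C' → D ≡ C')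
  where
    pre : Subset _ → Set
    pre D = Σ (Subset _) λ C → 𝒞 C × Empty (C ∩ I) × D ≡ (C ─ J)

sumℕ : {m : ℕ} → (Fin m → ℕ) → ℕ
sumℕ {zero}  f = 0
sumℕ {suc m} f = f Fin.zero ℕ.+ sumℕ (λ i → f (Fin.suc i))
  where import Data.Fin as Fin

sumℚ : {m : ℕ} → (Fin m → ℚ) → ℚ
sumℚ {zero}  f = 0ℚ
sumℚ {suc m} f = f Fin.zero ℚ.+ sumℚ (λ i → f (Fin.suc i))
  where import Data.Fin as Fin

sumOverℕ : {m : ℕ} → Subset m → (Fin m → ℕ) → ℕ
sumOverℕ C x = sumℕ (λ v → if does (v ∈? C) then x v else 0)
  where open Relation.Nullary using (does)

sumOverℚ : {m : ℕ} → Subset m → (Fin m → ℚ) → ℚ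
sumOverℚ C x = sumℚ (λ v → if does (v ∈? C) then x v else 0ℚ)
  where open Relation.Nullary using (does)

IsCover : {m : ℕ} → Family m → (Fin m → ℕ) → Set
IsCover 𝒞 x = ∀ C → 𝒞 C → 1 ℕ.≤ sumOverℕ C x

-- y ∈ ℤ₊^𝒞 with M(𝒞)ᵀ y ≤ 1, represented as a list of members (a multiset
-- of members, y(C) = multiplicity of C); 1ᵀy = length of the list.
count∋ : {m : ℕ} → Fin m → List (Subset m) → ℕ
count∋ v []       = 0
count∋ v (C ∷ Cs) = (if does (v ∈? C) then 1 else 0) ℕ.+ count∋ v Cs
  where open Relation.Nullary using (does)

IsPacking : {m : ℕ} → Family m → List (Subset m) → Set
IsPacking 𝒞 ys = All 𝒞 ys × (∀ v → count∋ v ys ℕ.≤ 1)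

IsTau : {m : ℕ} → Family m → ℕ → Set
IsTau 𝒞 t = (Σ _ λ x → IsCover 𝒞 x × sumℕ x ≡ t)
          × (∀ x → IsCover 𝒞 x → t ℕ.≤ sumℕ x)

IsNu : {m : ℕ} → Family m → ℕ → Set
IsNu 𝒞 t = (Σ _ λ ys → IsPacking 𝒞 ys × length ys ≡ t)
         × (∀ ys → IsPacking 𝒞 ys → length ys ℕ.≤ t)

TauInfinite : {m : ℕ} → Family m → Set
TauInfinite 𝒞 = ∀ x → ¬ IsCover 𝒞 x

NuInfinite : {m : ℕ} → Family m → Set
NuInfinite 𝒞 = ∀ k → Σ _ λ ys → IsPacking 𝒞 ys × k ℕ.≤ length ys

Packs : {m : ℕ} → Family m → Set
Packs 𝒞 = (Σ ℕ λ t → IsTau 𝒞 t × IsNu 𝒞 t) ⊎ (TauInfinite 𝒞 × NuInfinite 𝒞)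

-- Packing property and minimally non-packing, for a clutter with
-- ground set E ⊆ Fin m (minors over disjoint I, J ⊆ E; the minor
-- 𝒞 \ I / J has ground set E ─ (I ∪ J)).

HasPackingProperty : {m : ℕ} → Subset m → Family m → Set
HasPackingProperty E 𝒞 =
  ∀ I J → I ⊆ E → J ⊆ E → Empty (I ∩ J) → Packs (minor 𝒞 I J)

MinimallyNonPacking : {m : ℕ} → Subset m → Family m → Set
MinimallyNonPacking E 𝒞 =
  ¬ HasPackingProperty E 𝒞 ×
  (∀ I J → I ⊆ E → J ⊆ E → Empty (I ∩ J) → Nonempty (I ∪ J) →
     HasPackingProperty (E ─ (I ∪ J)) (minor 𝒞 I J))

-- Idealness (ground set: all of Fin m).  Polyhedron
-- P(𝒞) = { x ≥ 0 : M(𝒞) x ≥ 1 }, taken over ℚ.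

InP : {m : ℕ} → Family m → (Fin m → ℚ) → Set
InP 𝒞 x = (∀ v → 0ℚ ℚ.≤ x v) × (∀ C → 𝒞 C → 1ℚ ℚ.≤ sumOverℚ C x)

IsExtremePoint : {m : ℕ} → Family m → (Fin m → ℚ) → Set
IsExtremePoint 𝒞 x =
  InP 𝒞 x ×
  (∀ y z (λ' : ℚ) → InP 𝒞 y → InP 𝒞 z → 0ℚ ℚ.< λ' → λ' ℚ.< 1ℚ →
     (∀ v → x v ≡ (λ' ℚ.* y v) ℚ.+ ((1ℚ ℚ.- λ') ℚ.* z v)) →
     ∀ v → y v ≡ z v)

IsIntegral : {m : ℕ} → (Fin m → ℚ) → Set
IsIntegral x = ∀ v → Σ ℤ λ k → x v ≡ (k ℚ./ 1)

Ideal : {m : ℕ} → Family m → Set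
Ideal 𝒞 = ∀ x → IsExtremePoint 𝒞 x → IsIntegral x

{-# OPTIONS --safe #-}
-- A minimally non-packing clutter does not pack, but its proper minors do.
-- For mult(S), the copy V₁ of GF(q) is a cover of size q, and if S has a
-- nowhere-zero vector u, the transversals of the q multiples c·u are
-- pairwise disjoint, so mult(S) would pack.  A cover of size ≤ 1 is a
-- single point lying in every member, which would also make mult(S) pack;
-- hence τ(mult(S)) ≥ 2.  If GF(q) has an element a ∉ {0, 1}, delete the
-- point a of V₁: the zero vector survives, and every member that is lost is
-- the transversal of a multiple of a surviving one (scale by a⁻¹), so a
-- cover of size ≤ 1 of the deletion would cover mult(S).  The deletion
-- packs, so it has two disjoint members; the difference of their vectors is
-- nowhere zero, a contradiction.  Thus q = 2 and V₁ is a minimum cover.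
module Submission where

open import Defs
open import Algebra.Bundles using (CommutativeRing)
open import Algebra.Structures using (IsCommutativeRing)
import Algebra.Properties.CommutativeSemigroup as CommutativeSemigroupProperties
import Algebra.Properties.Ring as RingProperties
open import Data.Bool using (true; false; if_then_else_)
open import Data.Empty using (⊥; ⊥-elim)
open import Data.Fin using (Fin; zero; suc; combine; remQuot; splitAt; _↑ˡ_; _↑ʳ_; _≟_)
open import Data.Fin.Properties using (¬Fin0; 0≢1+n; suc-injective; combine-remQuot; remQuot-combine; splitAt-↑ˡ; splitAt-↑ʳ)
open import Data.Fin.Subset using (Subset; _∈_; _∉_; _⊆_; _∩_; _∪_; Empty; Nonempty; ⁅_⁆; ⊤)
  renaming (⊥ to ∅)
open import Data.Fin.Subset.Properties
  using (_∈?_; ∈⊤; ∉⊥; ⊥⊆; ⊆-antisym; nonempty?; Empty-unique; x∈p∩q⁻; x∈p∪q⁺; p─⊥≡p; x∈⁅x⁆; x∈⁅y⁆⇒x≡y)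
open import Data.List using (List; []; _∷_; length; tabulate)
open import Data.List.Properties using (length-tabulate)
open import Data.List.Relation.Unary.All as All using (All; []; _∷_)
open import Data.List.Relation.Unary.All.Properties using (tabulate⁺)
open import Data.Nat as Nat using (ℕ; zero; suc; _≤_; z≤n; s≤s)
open import Data.Nat.Properties
  using (≤-refl; ≤-trans; +-comm; +-assoc; +-monoʳ-≤; ≤-reflexive; ≤-antisym; +-mono-≤; m≤m+n; m≤n+m; *-monoˡ-≤; *-identityˡ; *-identityʳ; *-zeroʳ; +-identityʳ; +-commutativeSemigroup; <⇒≱; ≰⇒>)
open import Data.Product using (∃-syntax; _×_; _,_; proj₁; proj₂; uncurry; swap)
open import Data.Sum using (_⊎_; inj₁; inj₂; [_,_]′)
import Data.Vec as Vec
open import Data.Vec.Properties using (lookup∘tabulate; tabulate-cong; []=⇒lookup; lookup⇒[]=)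
open import Function using (_∘_; const; _∘₂_)
open import Level using (0ℓ)
open import Relation.Binary.PropositionalEquality
open import Relation.Nullary using (¬_; yes; no; does; contradiction)
open import Relation.Nullary.Decidable using (dec-true)
open import Relation.Unary using (_≐_)

module _ where
  open Nat using (_+_; _*_)
  open CommutativeSemigroupProperties +-commutativeSemigroup using (interchange)

  sumℕ-cong : ∀ {m} {f g : Fin m → ℕ} → f ≗ g → sumℕ f ≡ sumℕ g
  sumℕ-cong {zero}  f≗g = refl
  sumℕ-cong {suc m} f≗g = cong₂ _+_ (f≗g zero) (sumℕ-cong (f≗g ∘ suc))

  sumℕ-mono : ∀ {m} {f g : Fin m → ℕ} → (∀ v → f v ≤ g v) → sumℕ f ≤ sumℕ g
  sumℕ-mono {zero}  f≤g = z≤n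
  sumℕ-mono {suc m} f≤g = +-mono-≤ (f≤g zero) (sumℕ-mono (f≤g ∘ suc))

  sumℕ-distrib-+ : ∀ {m} (f g : Fin m → ℕ) → sumℕ (λ v → f v + g v) ≡ sumℕ f + sumℕ g
  sumℕ-distrib-+ {zero}  f g = refl
  sumℕ-distrib-+ {suc m} f g =
    trans (cong (f zero + g zero +_) (sumℕ-distrib-+ (f ∘ suc) (g ∘ suc)))
          (interchange (f zero) (g zero) (sumℕ (f ∘ suc)) (sumℕ (g ∘ suc)))

  sumℕ-const : ∀ m c → sumℕ {m} (const c) ≡ m * c
  sumℕ-const zero    c = refl
  sumℕ-const (suc m) c = cong (c +_) (sumℕ-const m c)

  sumℕ-splitAt : ∀ a b (f : Fin (a + b) → ℕ) →
                 sumℕ f ≡ sumℕ (f ∘ (_↑ˡ b)) + sumℕ (f ∘ (a ↑ʳ_))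
  sumℕ-splitAt zero    b f = refl
  sumℕ-splitAt (suc a) b f =
    trans (cong (f zero +_) (sumℕ-splitAt a b (f ∘ suc))) (sym (+-assoc (f zero) _ _))

  term≤sumℕ : ∀ {m} (f : Fin m → ℕ) v → f v ≤ sumℕ f
  term≤sumℕ f zero    = m≤m+n (f zero) _
  term≤sumℕ f (suc v) = ≤-trans (term≤sumℕ (f ∘ suc) v) (m≤n+m _ (f zero))

  1≤sumℕ⇒1≤term : ∀ {m} (f : Fin m → ℕ) → 1 ≤ sumℕ f → ∃[ v ] 1 ≤ f v
  1≤sumℕ⇒1≤term {suc m} f 1≤Σf with f zero in f₀≡
  ... | suc _ = zero , subst (1 ≤_) (sym f₀≡) (s≤s z≤n)
  ... | zero  = let v , 1≤fv = 1≤sumℕ⇒1≤term (f ∘ suc) 1≤Σf in suc v , 1≤fv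

  distinct-terms≤sumℕ : ∀ {m} (f : Fin m → ℕ) {v w} → v ≢ w → f v + f w ≤ sumℕ f
  distinct-terms≤sumℕ f {zero}  {zero}  v≢w = contradiction refl v≢w
  distinct-terms≤sumℕ f {zero}  {suc w} _   = +-monoʳ-≤ (f zero) (term≤sumℕ (f ∘ suc) w)
  distinct-terms≤sumℕ f {suc v} {zero}  _   =
    ≤-trans (≤-reflexive (+-comm (f (suc v)) (f zero))) (+-monoʳ-≤ (f zero) (term≤sumℕ (f ∘ suc) v))
  distinct-terms≤sumℕ f {suc v} {suc w} v≢w =
    ≤-trans (distinct-terms≤sumℕ (f ∘ suc) (v≢w ∘ cong suc)) (m≤n+m _ (f zero))

  sumℕ≤1⇒unique-support : ∀ {m} (f : Fin m → ℕ) → sumℕ f ≤ 1 →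
                          ∀ {v w} → 1 ≤ f v → 1 ≤ f w → v ≡ w
  sumℕ≤1⇒unique-support f Σf≤1 {v} {w} 1≤fv 1≤fw with v ≟ w
  ... | yes v≡w = v≡w
  ... | no  v≢w = contradiction Σf≤1 (<⇒≱ (≤-trans (+-mono-≤ 1≤fv 1≤fw) (distinct-terms≤sumℕ f v≢w)))

  ∈⇒≤sumOverℕ : ∀ {m} {C : Subset m} (x : Fin m → ℕ) {v} → v ∈ C → x v ≤ sumOverℕ C x
  ∈⇒≤sumOverℕ {C = C} x {v} v∈C =
    ≤-trans (≤-reflexive (cong (λ b → if b then x v else 0) (sym (dec-true (v ∈? C) v∈C))))
            (term≤sumℕ _ v)

  1≤sumOverℕ⇒∃ : ∀ {m} {C : Subset m} (x : Fin m → ℕ) → 1 ≤ sumOverℕ C x →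
                 ∃[ v ] v ∈ C × 1 ≤ x v
  1≤sumOverℕ⇒∃ {C = C} x 1≤ΣCx with 1≤sumℕ⇒1≤term _ 1≤ΣCx
  ... | v , 1≤term with v ∈? C
  ...   | yes v∈C = v , v∈C , 1≤term

  -- Double counting: this is the sum of the x-weights of the members of ys.
  packedWeight : ∀ {m} → List (Subset m) → (Fin m → ℕ) → ℕ
  packedWeight ys x = sumℕ (λ v → count∋ v ys * x v)

  packedWeight-∷ : ∀ {m} C ys (x : Fin m → ℕ) →
                   packedWeight (C ∷ ys) x ≡ sumOverℕ C x + packedWeight ys x
  packedWeight-∷ C ys x =
    trans (sumℕ-cong split) (sumℕ-distrib-+ (λ v → if does (v ∈? C) then x v else 0) (λ v → count∋ v ys * x v))
    where
    split : ∀ v → count∋ v (C ∷ ys) * x v ≡ (if does (v ∈? C) then x v else 0) + count∋ v ys * x v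
    split v with does (v ∈? C)
    ... | true  = refl
    ... | false = refl

  length≤packedWeight : ∀ {m} {𝒜 : Family m} {x} ys → All 𝒜 ys → IsCover 𝒜 x →
                        length ys ≤ packedWeight ys x
  length≤packedWeight []       []            _   = z≤n
  length≤packedWeight {x = x} (C ∷ ys) (C∈𝒜 ∷ ys∈𝒜) cov =
    ≤-trans (+-mono-≤ (cov C C∈𝒜) (length≤packedWeight ys ys∈𝒜 cov))
            (≤-reflexive (sym (packedWeight-∷ C ys x)))

  packedWeight≤sumℕ : ∀ {m} ys (x : Fin m → ℕ) → (∀ v → count∋ v ys ≤ 1) → packedWeight ys x ≤ sumℕ x
  packedWeight≤sumℕ ys x count≤1 =
    sumℕ-mono (λ v → ≤-trans (*-monoˡ-≤ (x v) (count≤1 v)) (≤-reflexive (*-identityˡ (x v))))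

  weak-duality : ∀ {m} {𝒜 : Family m} {ys x} → IsPacking 𝒜 ys → IsCover 𝒜 x → length ys ≤ sumℕ x
  weak-duality {ys = ys} {x} (ys∈𝒜 , count≤1) cov =
    ≤-trans (length≤packedWeight ys ys∈𝒜 cov) (packedWeight≤sumℕ ys x count≤1)

cover≡packing⇒packs : ∀ {m} {𝒜 : Family m} {x ys} →
                      IsCover 𝒜 x → IsPacking 𝒜 ys → sumℕ x ≡ length ys → Packs 𝒜
cover≡packing⇒packs {x = x} {ys} cov packing Σx≡len =
  inj₁ (length ys , ((x , cov , Σx≡len) , λ _ → weak-duality packing)
                  , ((ys , packing , refl) , λ _ packing′ → subst (_ ≤_) Σx≡len (weak-duality packing′ cov)))

cover≤1⇒packs : ∀ {m} {𝒜 : Family m} {C x} → 𝒜 C → IsCover 𝒜 x → sumℕ x ≤ 1 → Packs 𝒜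
cover≤1⇒packs {C = C} {x} C∈𝒜 cov Σx≤1 =
  cover≡packing⇒packs cov ((C∈𝒜 ∷ []) , count≤1) (≤-antisym Σx≤1 1≤Σx)
  where
  1≤Σx : 1 ≤ sumℕ x
  1≤Σx = let v , _ , 1≤xv = 1≤sumOverℕ⇒∃ x (cov C C∈𝒜) in ≤-trans 1≤xv (term≤sumℕ x v)
  count≤1 : ∀ v → count∋ v (C ∷ []) ≤ 1
  count≤1 v with does (v ∈? C)
  ... | true  = ≤-refl
  ... | false = z≤n

cover≤1⇒common-point : ∀ {m} {𝒜 : Family m} {C₀ x} → 𝒜 C₀ → IsCover 𝒜 x → sumℕ x ≤ 1 →
                       ∃[ v ] v ∈ C₀ × 1 ≤ x v × (∀ {C} → 𝒜 C → v ∈ C)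
cover≤1⇒common-point {𝒜 = 𝒜} {C₀} {x} C₀∈𝒜 cov Σx≤1 =
  let v , v∈C₀ , 1≤xv = 1≤sumOverℕ⇒∃ x (cov C₀ C₀∈𝒜) in v , v∈C₀ , 1≤xv , in-every-member 1≤xv
  where
  in-every-member : ∀ {v} → 1 ≤ x v → ∀ {C} → 𝒜 C → v ∈ C
  in-every-member 1≤xv {C} C∈𝒜 =
    let w , w∈C , 1≤xw = 1≤sumOverℕ⇒∃ x (cov C C∈𝒜)
    in subst (_∈ C) (sumℕ≤1⇒unique-support x Σx≤1 1≤xw 1≤xv) w∈C

τ≥2∧packs⇒disjoint-pair : ∀ {m} {𝒜 : Family m} {x₀} → IsCover 𝒜 x₀ →
                          (∀ {x} → IsCover 𝒜 x → 2 ≤ sumℕ x) → Packs 𝒜 →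
                          ∃[ C ] ∃[ D ] ∃[ ys ] IsPacking 𝒜 (C ∷ D ∷ ys)
τ≥2∧packs⇒disjoint-pair {x₀ = x₀} cov₀ _ (inj₂ (no-cover , _)) = ⊥-elim (no-cover x₀ cov₀)
τ≥2∧packs⇒disjoint-pair _ τ≥2 (inj₁ (_ , ((x , cov , Σx≡t) , _) , ((ys , packing , len≡t) , _))) =
  pair ys packing (subst (2 ≤_) (trans Σx≡t (sym len≡t)) (τ≥2 cov))
  where
  pair : ∀ ys → IsPacking _ ys → 2 ≤ length ys → ∃[ C ] ∃[ D ] ∃[ ys′ ] IsPacking _ (C ∷ D ∷ ys′)
  pair (C ∷ D ∷ ys) packing _         = C , D , ys , packing
  pair (_ ∷ [])     _       (s≤s ())

count∋≤1⇒disjoint : ∀ {m} {v : Fin m} C D ys → count∋ v (C ∷ D ∷ ys) ≤ 1 → v ∈ C → v ∉ D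
count∋≤1⇒disjoint {v = v} C D ys count≤1 v∈C v∈D with v ∈? C | v ∈? D | count≤1
... | yes _   | yes _   | s≤s ()
... | no v∉C  | _       | _ = v∉C v∈C
... | yes _   | no v∉D  | _ = v∉D v∈D

count∋-tabulate≡0 : ∀ {m k} {v : Fin m} (f : Fin k → Subset m) → (∀ c → v ∉ f c) →
                    count∋ v (tabulate f) ≡ 0
count∋-tabulate≡0 {k = zero}      _ _  = refl
count∋-tabulate≡0 {k = suc k} {v} f v∉ with v ∈? f zero
... | yes v∈ = contradiction v∈ (v∉ zero)
... | no  _  = count∋-tabulate≡0 (f ∘ suc) (v∉ ∘ suc)

count∋-tabulate≤1 : ∀ {m k} {v : Fin m} (f : Fin k → Subset m) →
                    (∀ {c c′} → v ∈ f c → v ∈ f c′ → c ≡ c′) → count∋ v (tabulate f) ≤ 1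
count∋-tabulate≤1 {k = zero}      _ _      = z≤n
count∋-tabulate≤1 {k = suc k} {v} f unique with v ∈? f zero
... | yes v∈ = ≤-reflexive (cong suc (count∋-tabulate≡0 (f ∘ suc) λ c v∈′ → 0≢1+n (unique v∈ v∈′)))
... | no  _  = count∋-tabulate≤1 (f ∘ suc) (suc-injective ∘₂ unique)

IsClutter : ∀ {m} → Family m → Set
IsClutter 𝒜 = ∀ {C D} → 𝒜 C → 𝒜 D → C ⊆ D → C ≡ D

IsCover-anti : ∀ {m} {𝒜 ℬ : Family m} {x} → (∀ {C} → ℬ C → 𝒜 C) → IsCover 𝒜 x → IsCover ℬ x
IsCover-anti ℬ⊆𝒜 cov C C∈ℬ = cov C (ℬ⊆𝒜 C∈ℬ)

IsPacking-mono : ∀ {m} {𝒜 ℬ : Family m} {ys} → (∀ {C} → 𝒜 C → ℬ C) → IsPacking 𝒜 ys → IsPacking ℬ ys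
IsPacking-mono 𝒜⊆ℬ (ys∈𝒜 , count≤1) = All.map 𝒜⊆ℬ ys∈𝒜 , count≤1

Packs-resp-≐ : ∀ {m} {𝒜 ℬ : Family m} → 𝒜 ≐ ℬ → Packs 𝒜 → Packs ℬ
Packs-resp-≐ (𝒜⊆ℬ , ℬ⊆𝒜) (inj₁ (t , ((x , cov , Σx≡t) , τ-min) , ((ys , packing , len≡t) , ν-max))) =
  inj₁ (t , ((x , IsCover-anti ℬ⊆𝒜 cov , Σx≡t) , λ x′ → τ-min x′ ∘ IsCover-anti 𝒜⊆ℬ)
          , ((ys , IsPacking-mono 𝒜⊆ℬ packing , len≡t) , λ ys′ → ν-max ys′ ∘ IsPacking-mono ℬ⊆𝒜))
Packs-resp-≐ (𝒜⊆ℬ , _) (inj₂ (no-cover , big-packings)) =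
  inj₂ ( (λ x → no-cover x ∘ IsCover-anti 𝒜⊆ℬ)
       , (λ k → let ys , packing , k≤len = big-packings k in ys , IsPacking-mono 𝒜⊆ℬ packing , k≤len))

∩∅-empty : ∀ {m} (C : Subset m) → Empty (C ∩ ∅)
∩∅-empty C (_ , v∈C∩∅) = ∉⊥ (proj₂ (x∈p∩q⁻ C ∅ v∈C∩∅))

minor-isClutter : ∀ {m} (𝒜 : Family m) I J → IsClutter (minor 𝒜 I J)
minor-isClutter 𝒜 I J (C-candidate , _) (_ , D-minimal) C⊆D = D-minimal _ C-candidate C⊆D

deletion⁻ : ∀ {m} {𝒜 : Family m} {I C} → minor 𝒜 I ∅ C → 𝒜 C × Empty (C ∩ I)
deletion⁻ {𝒜 = 𝒜} {I} ((C₀ , C₀∈𝒜 , C₀∩I-empty , C≡C₀─∅) , _) =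
  subst (λ C → 𝒜 C × Empty (C ∩ I)) (sym (trans C≡C₀─∅ (p─⊥≡p C₀))) (C₀∈𝒜 , C₀∩I-empty)

deletion⁺ : ∀ {m} {𝒜 : Family m} {I C} → IsClutter 𝒜 → 𝒜 C → Empty (C ∩ I) → minor 𝒜 I ∅ C
deletion⁺ {C = C} clutter C∈𝒜 C∩I-empty =
  (C , C∈𝒜 , C∩I-empty , sym (p─⊥≡p C)) ,
  λ { D (C₀ , C₀∈𝒜 , _ , D≡C₀─∅) D⊆C →
        let D≡C₀ = trans D≡C₀─∅ (p─⊥≡p C₀)
        in trans D≡C₀ (clutter C₀∈𝒜 C∈𝒜 (subst (_⊆ C) D≡C₀ D⊆C)) }

minor-∅-∅≐ : ∀ {m} {𝒜 : Family m} → IsClutter 𝒜 → minor 𝒜 ∅ ∅ ≐ 𝒜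
minor-∅-∅≐ clutter = proj₁ ∘ deletion⁻ , λ {C} C∈𝒜 → deletion⁺ clutter C∈𝒜 (∩∅-empty C)

mnp⇒proper-minor-packs : ∀ {m} {𝒜 : Family m} {I J} → MinimallyNonPacking ⊤ 𝒜 →
                         Empty (I ∩ J) → Nonempty (I ∪ J) → Packs (minor 𝒜 I J)
mnp⇒proper-minor-packs {𝒜 = 𝒜} {I} {J} (_ , proper-minors) I∩J-empty I∪J-nonempty =
  Packs-resp-≐ (minor-∅-∅≐ (minor-isClutter 𝒜 I J))
    (proper-minors I J (const ∈⊤) (const ∈⊤) I∩J-empty I∪J-nonempty ∅ ∅ ⊥⊆ ⊥⊆ (∩∅-empty ∅))

mnp⇒¬packs : ∀ {m} {𝒜 : Family m} → IsClutter 𝒜 → MinimallyNonPacking ⊤ 𝒜 → ¬ Packs 𝒜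
mnp⇒¬packs {𝒜 = 𝒜} clutter mnp@(¬packing-property , _) 𝒜-packs = ¬packing-property packing-property
  where
  packing-property : HasPackingProperty ⊤ 𝒜
  packing-property I J _ _ I∩J-empty with nonempty? (I ∪ J)
  ... | yes I∪J-nonempty = mnp⇒proper-minor-packs mnp I∩J-empty I∪J-nonempty
  ... | no  I∪J-empty    =
    subst₂ (λ I J → Packs (minor 𝒜 I J))
      (sym (Empty-unique (λ (v , v∈I) → I∪J-empty (v , x∈p∪q⁺ (inj₁ v∈I)))))
      (sym (Empty-unique (λ (v , v∈J) → I∪J-empty (v , x∈p∪q⁺ (inj₂ v∈J)))))
      (Packs-resp-≐ (swap (minor-∅-∅≐ clutter)) 𝒜-packs)

module _ {n q : ℕ} where

  transversal : (Fin n → Fin q) → Subset (n Nat.* q)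
  transversal s = Vec.tabulate (uncurry (λ i a → does (s i ≟ a)) ∘ remQuot {n} q)

  lookup-transversal : ∀ s i a → Vec.lookup (transversal s) (combine i a) ≡ does (s i ≟ a)
  lookup-transversal s i a =
    trans (lookup∘tabulate _ (combine i a)) (cong (uncurry (λ i a → does (s i ≟ a))) (remQuot-combine i a))

  combine∈transversal : ∀ s i → combine i (s i) ∈ transversal s
  combine∈transversal s i =
    lookup⇒[]= (combine i (s i)) (transversal s) (trans (lookup-transversal s i (s i)) (dec-true (s i ≟ s i) refl))

  combine∈transversal⇒ : ∀ s {i a} → combine i a ∈ transversal s → s i ≡ a
  combine∈transversal⇒ s {i} {a} ia∈T with s i ≟ a | lookup-transversal s i a
  ... | yes si≡a | _         = si≡a
  ... | no  _    | lookup≡no = contradiction (trans (sym lookup≡no) ([]=⇒lookup ia∈T)) λ ()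

  ∈transversal⇒ : ∀ s {v} → v ∈ transversal s → ∃[ i ] v ≡ combine i (s i)
  ∈transversal⇒ s {v} v∈T = i , trans (sym ia≡v) (cong (combine i) (sym si≡a))
    where
    i = proj₁ (remQuot {n} q v)
    a = proj₂ (remQuot {n} q v)
    ia≡v : combine i a ≡ v
    ia≡v = combine-remQuot {n} q v
    si≡a : s i ≡ a
    si≡a = combine∈transversal⇒ s (subst (_∈ transversal s) (sym ia≡v) v∈T)

  transversal-⊆⇒≡ : ∀ {s t} → transversal s ⊆ transversal t → transversal s ≡ transversal t
  transversal-⊆⇒≡ {s} {t} T⊆T′ = tabulate-cong λ v → cong (λ b → does (b ≟ proj₂ (remQuot {n} q v))) (s≗t _)
    where
    s≗t : s ≗ t
    s≗t i = sym (combine∈transversal⇒ t (T⊆T′ (combine∈transversal s i)))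

  mult-transversal : ∀ {S s} → S s → mult S (transversal s)
  mult-transversal {s = s} s∈S =
    s , s∈S , λ v → ∈transversal⇒ s , λ { (i , refl) → combine∈transversal s i }

  mult⇒transversal : ∀ {S C} → mult S C → ∃[ s ] S s × C ≡ transversal s
  mult⇒transversal (s , s∈S , C≈T) = s , s∈S , ⊆-antisym C⊆T (λ v∈T → proj₂ (C≈T _) (∈transversal⇒ s v∈T))
    where
    C⊆T : ∀ {v} → v ∈ _ → v ∈ transversal s
    C⊆T v∈C with proj₁ (C≈T _) v∈C
    ... | i , refl = combine∈transversal s i

  mult-isClutter : ∀ {S : (Fin n → Fin q) → Set} → IsClutter (mult S)
  mult-isClutter C∈ D∈ C⊆D with mult⇒transversal C∈ | mult⇒transversal D∈
  ... | s , _ , refl | t , _ , refl = transversal-⊆⇒≡ {s} {t} C⊆D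

module _ {n q : ℕ} where

  -- combine zero a is a ↑ˡ (n * q), so splitAt q separates V₁ from the other copies.
  firstCopy : Fin (suc n Nat.* q) → ℕ
  firstCopy v = [ const 1 , const 0 ]′ (splitAt q v)

  firstCopy-weight : sumℕ firstCopy ≡ q
  firstCopy-weight = begin
    sumℕ firstCopy
      ≡⟨ sumℕ-splitAt q (n Nat.* q) firstCopy ⟩
    sumℕ (firstCopy ∘ (_↑ˡ n Nat.* q)) Nat.+ sumℕ (firstCopy ∘ (q ↑ʳ_))
      ≡⟨ cong₂ Nat._+_ (sumℕ-cong (cong [ const 1 , const 0 ]′ ∘ λ a → splitAt-↑ˡ q a (n Nat.* q)))
                       (sumℕ-cong (cong [ const 1 , const 0 ]′ ∘ splitAt-↑ʳ q (n Nat.* q))) ⟩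
    sumℕ {q} (const 1) Nat.+ sumℕ {n Nat.* q} (const 0)
      ≡⟨ cong₂ Nat._+_ (trans (sumℕ-const q 1) (*-identityʳ q)) (trans (sumℕ-const (n Nat.* q) 0) (*-zeroʳ (n Nat.* q))) ⟩
    q Nat.+ 0
      ≡⟨ +-identityʳ q ⟩
    q ∎
    where open ≡-Reasoning

  firstCopy-covers-mult : ∀ {S : (Fin (suc n) → Fin q) → Set} → IsCover (mult S) firstCopy
  firstCopy-covers-mult C C∈mult with mult⇒transversal C∈mult
  ... | s , _ , refl =
    ≤-trans (≤-reflexive (sym (cong [ const 1 , const 0 ]′ (splitAt-↑ˡ q (s zero) (n Nat.* q)))))
            (∈⇒≤sumOverℕ firstCopy (combine∈transversal s zero))

module FieldProperties {q : ℕ} (F : FiniteField q) where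
  open FiniteField F
  private module R = IsCommutativeRing isCommutativeRing

  commutativeRing : CommutativeRing 0ℓ 0ℓ
  commutativeRing = record
    { Carrier = Fin q ; _≈_ = _≡_ ; _+_ = _+_ ; _*_ = _*_ ; -_ = -_ ; 0# = 0# ; 1# = 1#
    ; isCommutativeRing = isCommutativeRing }

  open RingProperties (CommutativeRing.ring commutativeRing) using (-1*x≈-x; x∙y⁻¹≈ε⇒x≈y)

  x+-1*y≡0⇒x≡y : ∀ x y → x + ((- 1#) * y) ≡ 0# → x ≡ y
  x+-1*y≡0⇒x≡y x y x-y≡0 = x∙y⁻¹≈ε⇒x≈y x y (trans (cong (x +_) (sym (-1*x≈-x y))) x-y≡0)

  *-cancelʳ-≢0 : ∀ {u} c c′ → u ≢ 0# → c * u ≡ c′ * u → c ≡ c′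
  *-cancelʳ-≢0 {u} c c′ u≢0 cu≡c′u = trans (undo c) (trans (cong (_* w) cu≡c′u) (sym (undo c′)))
    where
    w = proj₁ (inverse u u≢0)
    undo : ∀ c → c ≡ (c * u) * w
    undo c = sym (trans (R.*-assoc c u w) (trans (cong (c *_) (proj₂ (inverse u u≢0))) (R.*-identityʳ c)))

  invertible-*≡0⇒≡0 : ∀ {a d w} → a * d ≡ 1# → d * w ≡ 0# → w ≡ 0#
  invertible-*≡0⇒≡0 {a} {d} {w} ad≡1 dw≡0 = begin
    w            ≡⟨ R.*-identityˡ w ⟨
    1# * w       ≡⟨ cong (_* w) ad≡1 ⟨
    (a * d) * w  ≡⟨ R.*-assoc a d w ⟩
    a * (d * w)  ≡⟨ cong (a *_) dw≡0 ⟩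
    a * 0#       ≡⟨ R.zeroʳ a ⟩
    0#           ∎
    where open ≡-Reasoning

avoid-two : ∀ {k} (x y : Fin (3 Nat.+ k)) → ∃[ a ] a ≢ x × a ≢ y
avoid-two zero                zero          = suc zero , (λ ()) , (λ ())
avoid-two zero                (suc zero)    = suc (suc zero) , (λ ()) , (λ ())
avoid-two zero                (suc (suc _)) = suc zero , (λ ()) , (λ ())
avoid-two (suc zero)          zero          = suc (suc zero) , (λ ()) , (λ ())
avoid-two (suc zero)          (suc _)       = zero , (λ ()) , (λ ())
avoid-two (suc (suc _))       zero          = suc zero , (λ ()) , (λ ())
avoid-two (suc (suc _))       (suc _)       = zero , (λ ()) , (λ ())

q≡2⊎third-element : ∀ {q} (F : FiniteField q) →
                    q ≡ 2 ⊎ ∃[ a ] a ≢ FiniteField.0# F × a ≢ FiniteField.1# F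
q≡2⊎third-element {0}                 F = ⊥-elim (¬Fin0 (FiniteField.0# F))
q≡2⊎third-element {1}                 F = ⊥-elim (FiniteField.0≢1 F (Fin1-unique _ _))
  where
  Fin1-unique : (a b : Fin 1) → a ≡ b
  Fin1-unique zero zero = refl
q≡2⊎third-element {2}                 F = inj₁ refl
q≡2⊎third-element {suc (suc (suc k))} F = inj₂ (avoid-two (FiniteField.0# F) (FiniteField.1# F))

module _ {q n : ℕ} (F : FiniteField q) {S : (Fin (suc n) → Fin q) → Set}
         (S-subspace : IsSubspace F (suc n) S) where
  open FiniteField F
  open IsSubspace S-subspace
  open FieldProperties F

  nowhere-zero⇒mult-packs : ∀ {u} → S u → (∀ i → u i ≢ 0#) → Packs (mult S)
  nowhere-zero⇒mult-packs {u} u∈S u≢0 =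
    cover≡packing⇒packs (firstCopy-covers-mult {n})
      (tabulate⁺ (λ c → mult-transversal (·-closed c u∈S)) , λ _ → count∋-tabulate≤1 multiple multiples-disjoint)
      (trans (firstCopy-weight {n}) (sym (length-tabulate multiple)))
    where
    multiple : Fin q → Subset (suc n Nat.* q)
    multiple c = transversal (λ i → c * u i)
    multiples-disjoint : ∀ {v c c′} → v ∈ multiple c → v ∈ multiple c′ → c ≡ c′
    multiples-disjoint {c = c} {c′} v∈ v∈′ with ∈transversal⇒ (λ i → c * u i) v∈
    ... | i , refl = *-cancelʳ-≢0 c c′ (u≢0 i) (sym (combine∈transversal⇒ (λ i → c′ * u i) v∈′))

  disjoint-pair⇒mult-packs : ∀ {D₁ D₂ ys} → mult S D₁ → mult S D₂ →
                             (∀ v → count∋ v (D₁ ∷ D₂ ∷ ys) ≤ 1) → Packs (mult S)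
  disjoint-pair⇒mult-packs {ys = ys} D₁∈ D₂∈ count≤1 with mult⇒transversal D₁∈ | mult⇒transversal D₂∈
  ... | s₁ , s₁∈S , refl | s₂ , s₂∈S , refl =
    nowhere-zero⇒mult-packs (+-closed s₁∈S (·-closed (- 1#) s₂∈S)) s₁-s₂≢0
    where
    s₁-s₂≢0 : ∀ i → s₁ i + ((- 1#) * s₂ i) ≢ 0#
    s₁-s₂≢0 i s₁-s₂≡0 =
      count∋≤1⇒disjoint (transversal s₁) (transversal s₂) ys (count≤1 (combine i (s₁ i))) (combine∈transversal s₁ i)
        (subst (λ b → combine i b ∈ transversal s₂) (sym (x+-1*y≡0⇒x≡y _ _ s₁-s₂≡0)) (combine∈transversal s₂ i))

  module _ (mnp : MinimallyNonPacking ⊤ (mult S)) where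

    mult-cover-weight≥2 : ∀ {x} → IsCover (mult S) x → 2 ≤ sumℕ x
    mult-cover-weight≥2 cov =
      ≰⇒> (mnp⇒¬packs mult-isClutter mnp ∘ cover≤1⇒packs (mult-transversal zero∈) cov)

    mult-τ≡2 : q ≡ 2 → IsTau (mult S) 2
    mult-τ≡2 q≡2 =
      (firstCopy {n} , firstCopy-covers-mult , trans (firstCopy-weight {n}) q≡2) , λ _ → mult-cover-weight≥2

    module _ (a : Fin q) (a≢0 : a ≢ 0#) (a≢1 : a ≢ 1#) where

      a₁ : Fin (suc n Nat.* q)
      a₁ = combine {suc n} zero a

      mult∖a : Family (suc n Nat.* q)
      mult∖a = minor (mult S) ⁅ a₁ ⁆ ∅

      transversal∈mult∖a : ∀ {s} → S s → s zero ≢ a → mult∖a (transversal s)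
      transversal∈mult∖a {s} s∈S s₀≢a = deletion⁺ mult-isClutter (mult-transversal s∈S) avoids-a
        where
        avoids-a : Empty (transversal s ∩ ⁅ a₁ ⁆)
        avoids-a (v , v∈) =
          let v∈T , v∈⁅⁆ = x∈p∩q⁻ (transversal s) _ v∈
          in s₀≢a (combine∈transversal⇒ s (subst (_∈ transversal s) (x∈⁅y⁆⇒x≡y a₁ v∈⁅⁆) v∈T))

      -- If s zero ≡ a, then a⁻¹·s survives the deletion: its first coordinate is 1 ≢ a.
      vanishes-off-a⇒vanishes : ∀ j → (∀ {s} → S s → s zero ≢ a → s j ≡ 0#) → ∀ {s} → S s → s j ≡ 0#
      vanishes-off-a⇒vanishes j vanishes-off-a {s} s∈S with s zero ≟ a
      ... | no  s₀≢a = vanishes-off-a s∈S s₀≢a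
      ... | yes s₀≡a =
        let d , ad≡1 = inverse a a≢0
            ds₀≡1 = trans (cong (d *_) s₀≡a) (trans (*-comm d a) ad≡1)
        in invertible-*≡0⇒≡0 ad≡1 (vanishes-off-a (·-closed d s∈S) (λ ds₀≡a → a≢1 (trans (sym ds₀≡a) ds₀≡1)))
        where open IsCommutativeRing isCommutativeRing using (*-comm)

      mult∖a-cover≤1⇒mult-cover : ∀ {x} → IsCover mult∖a x → sumℕ x ≤ 1 → IsCover (mult S) x
      mult∖a-cover≤1⇒mult-cover {x} cov Σx≤1 C C∈mult
        with cover≤1⇒common-point (transversal∈mult∖a zero∈ (a≢0 ∘ sym)) cov Σx≤1
      ... | v , v∈T₀ , 1≤xv , v∈mult∖a with ∈transversal⇒ (const 0#) v∈T₀ | mult⇒transversal C∈mult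
      ... | j , refl | s , s∈S , refl =
        ≤-trans 1≤xv (∈⇒≤sumOverℕ x (subst (λ b → combine j b ∈ transversal s) (sj≡0 s∈S) (combine∈transversal s j)))
        where
        sj≡0 : ∀ {s} → S s → s j ≡ 0#
        sj≡0 = vanishes-off-a⇒vanishes j λ {s} s∈S s₀≢a →
          combine∈transversal⇒ s (v∈mult∖a (transversal∈mult∖a s∈S s₀≢a))

      mult∖a-cover-weight≥2 : ∀ {x} → IsCover mult∖a x → 2 ≤ sumℕ x
      mult∖a-cover-weight≥2 cov =
        ≰⇒> λ Σx≤1 → <⇒≱ (mult-cover-weight≥2 (mult∖a-cover≤1⇒mult-cover cov Σx≤1)) Σx≤1

      no-third-element : ⊥
      no-third-element = contradict (τ≥2∧packs⇒disjoint-pair mult∖a-covered mult∖a-cover-weight≥2 mult∖a-packs)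
        where
        mult∖a-covered : IsCover mult∖a (firstCopy {n})
        mult∖a-covered = IsCover-anti (proj₁ ∘ deletion⁻) firstCopy-covers-mult
        mult∖a-packs : Packs mult∖a
        mult∖a-packs = mnp⇒proper-minor-packs mnp (∩∅-empty ⁅ a₁ ⁆) (a₁ , x∈p∪q⁺ (inj₁ (x∈⁅x⁆ a₁)))
        contradict : ∃[ D₁ ] ∃[ D₂ ] ∃[ ys ] IsPacking mult∖a (D₁ ∷ D₂ ∷ ys) → ⊥
        contradict (_ , _ , ys , (D₁∈ ∷ D₂∈ ∷ _ , count≤1)) =
          mnp⇒¬packs mult-isClutter mnp
            (disjoint-pair⇒mult-packs {ys = ys} (proj₁ (deletion⁻ D₁∈)) (proj₁ (deletion⁻ D₂∈)) count≤1)

corollary1p6 : (q : ℕ) → IsPrimePower q → (F : FiniteField q) →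
    (n : ℕ) → 1 ≤ n → (S : (Fin n → Fin q) → Set) → IsSubspace F n S →
    Ideal (mult {q} {n} S) → MinimallyNonPacking ⊤ (mult {q} {n} S) →
    IsTau (mult {q} {n} S) 2
corollary1p6 q _ F zero    ()
corollary1p6 q _ F (suc n) _  S S-subspace _ mnp with q≡2⊎third-element F
... | inj₁ q≡2             = mult-τ≡2 F S-subspace mnp q≡2
... | inj₂ (a , a≢0 , a≢1) = ⊥-elim (no-third-element F S-subspace mnp a a≢0 a≢1)
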